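{- Let $\Gamma=(V,U,E)$ be a bipartite graph, $n=|E|$, and let $\bar E_G$ be a generator order of $E$ (identifying $E$ with $[n]$). Let $G_i\in\bigotimes_{e\in E_i}A_e$ for $x_i\in V$, $G=\bigotimes_iG_i$, and suppose that for each $x_i\in V$ there is a skew-symmetric $z_i$ with $\mathrm{sPf}(z_i)=G_i$ (indexed via the restriction of $\bar E_G$ to $E_i$). Let $z$ be the skew-symmetric $n\times n$ matrix with $\mathrm{sPf}(z)=G$ in the $\bar E_G$ indexing. Then for every $I\subseteq[n]$, $$G_I=\mathrm{Pfaff}(z_I)=\sum_{S\in\mathscr{S}(\Gamma_I)}(-1)^{\mathrm{cr}(S)}z_S,$$ where $z_S=\prod_{(e,e')\in S}z_{e,e'}$.
   Context: For each edge $e$, $A_e\cong\mathbb{C}^2$ with basis $a_{e|0},a_{e|1}$; $E_i$ is the set of edges incident to $x_i$. A generator order is a linear order of $E$ in which the edges incident to each $x_i\in V$ are consecutive. Indexing: for a linear order $(f_1,\dots,f_k)$ of a set of edges $F$, the coordinate $T_I$ of $T\in\bigotimes_{e\in F}A_e$ is the coefficient of $a_{f_1|\varepsilon_1}\otimes\cdots\otimes a_{f_k|\varepsilon_k}$ with $\varepsilon_j=1$ iff $j\in I$. For a skew-symmetric $z$, $\mathrm{sPf}(z)_I=\mathrm{Pfaff}(z_I)$, with $z_I$ the principal submatrix on $I$ in increasing order ($\mathrm{Pfaff}$ of the empty matrix is $1$, of odd-size matrices $0$). For $I\subseteq E$, $\Gamma_I$ is the subgraph induced by the edges in $I$, and $\mathscr{S}(\Gamma_I)$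 is the set of partitions $S=\{(e_1,e_1'),\dots,(e_k,e_k')\}$ of $I$ into unordered pairs such that the two edges of each pair share an endpoint in $V$; each pair is written with $e_r<e_r'$ in $\bar E_G$. The crossing number is $\mathrm{cr}(S)=\#\{(r,s): e_r<e_s<e_r'<e_s'\}$, computed with respect to $\bar E_G$. -}

module Defs where

open import Level using (Level)
open import Data.Nat using (ℕ; zero; suc)
open import Data.Bool using (Bool; true; false; _∧_; if_then_else_)
open import Data.Fin using (Fin) renaming (_≟_ to _≟ᶠ_)
open import Data.Fin.Properties using (_<?_)
open import Data.Fin.Subset using (Subset; _∩_; _⊆_)
open import Data.List using (List; []; _∷_; map; concatMap; length; filterᵇ; allFin)
open import Data.Vec using (Vec; []; _∷_; lookup; tabulate; fromList)
open import Data.Product using (_×_; _,_; Σ; ∃)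
open import Function using (Injective; _∘_)
open import Relation.Nullary using (does)
open import Relation.Binary.PropositionalEquality using (_≡_)
open import Algebra.Bundles using (CommutativeRing)

-- Bipartite graph Γ = (V, U, E) with V = Fin p, U = Fin q, E = Fin n.
-- Edges are identified with [n] = Fin n via the order Ē_G (the natural
-- order of Fin n).

record BipartiteGraph (p q n : ℕ) : Set where
  field
    vtx    : Fin n → Fin p
    utx    : Fin n → Fin q
    simple : ∀ e e' → vtx e ≡ vtx e' → utx e ≡ utx e' → e ≡ e'

-- The natural order of Fin n is a generator order: the edges incident to
-- each x_i ∈ V are consecutive.
IsGeneratorOrder : ∀ {p q n} → BipartiteGraph p q n → Set
IsGeneratorOrder {n = n} Γ =
  ∀ (a b c : Fin n) → (a Data.Fin.< b) → (b Data.Fin.< c) →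
    vtx a ≡ vtx c → vtx b ≡ vtx a
  where open BipartiteGraph Γ

incident : ∀ {p q n} → BipartiteGraph p q n → Fin p → Subset n
incident Γ i = tabulate (λ e → does (BipartiteGraph.vtx Γ e ≟ᶠ i))

elems : ∀ {n} → Subset n → List (Fin n)
elems {n} I = filterᵇ (lookup I) (allFin n)

-- ways to pick one element of a list: (element, 0-based position, rest)
picks : ∀ {a} {A : Set a} {m} → Vec A (suc m) → List (A × ℕ × Vec A m)
picks {m = zero}  (x ∷ [])     = (x , 0 , []) ∷ []
picks {m = suc m} (x ∷ xs)     =
  (x , 0 , xs) ∷ map (λ { (y , k , ys) → (y , suc k , x ∷ ys) }) (picks xs)

-- all partitions of a (strictly increasing) list into consecutive-free
-- pairs (a , b); each pair is listed with its first element occurring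
-- before the second in the list.
pairings : ∀ {a} {A : Set a} (m : ℕ) → Vec A m → List (List (A × A))
pairings zero          []       = [] ∷ []
pairings (suc zero)    _        = []
pairings (suc (suc m)) (x ∷ xs) =
  concatMap (λ { (y , _ , ys) → map ((x , y) ∷_) (pairings m ys) }) (picks xs)

module _ {c ℓ} (R : CommutativeRing c ℓ) where
  open CommutativeRing R

  sumL : List Carrier → Carrier
  sumL []       = 0#
  sumL (x ∷ xs) = x + sumL xs

  prodL : List Carrier → Carrier
  prodL []       = 1#
  prodL (x ∷ xs) = x * prodL xs

  prodFin : ∀ {p} → (Fin p → Carrier) → Carrier
  prodFin f = prodL (map f (allFin _))

  negPow : ℕ → Carrier → Carrier
  negPow zero    x = x
  negPow (suc k) x = - negPow k x

  Matrix : ℕ → Set c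
  Matrix n = Fin n → Fin n → Carrier

  SkewSymmetric : ∀ {n} → Matrix n → Set ℓ
  SkewSymmetric {n} z = (∀ a b → z a b ≈ - z b a) × (∀ a → z a a ≈ 0#)

  -- Pfaffian of the principal submatrix of z on the index list v (in the
  -- given order), by expansion along the first row:
  --   Pf(A) = Σ_{j ≥ 2} (-1)^j a_{1j} Pf(A with rows/cols 1, j removed),
  -- Pf of the empty matrix = 1, of odd-size matrices = 0.
  PfaffVec : ∀ {n} → Matrix n → (m : ℕ) → Vec (Fin n) m → Carrier
  PfaffVec z zero          []       = 1#
  PfaffVec z (suc zero)    _        = 0#
  PfaffVec z (suc (suc m)) (a ∷ xs) =
    sumL (map (λ { (b , k , ys) → negPow k (z a b * PfaffVec z m ys) }) (picks xs))

  PfaffSub : ∀ {n} → Matrix n → Subset n → Carrier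
  PfaffSub z I = PfaffVec z _ (fromList (elems I))

  -- Tensors in ⊗_{e ∈ E} A_e, given by their coordinates T_I, I ⊆ E.
  Tensor : ℕ → Set c
  Tensor n = Subset n → Carrier

  sPf : ∀ {n} → Matrix n → Tensor n
  sPf z I = PfaffSub z I

  -- tensor product G = ⊗_i G_i, where G_i is a tensor on E_i (given by its
  -- values on subsets of E_i): G_I = ∏_i (G_i)_{I ∩ E_i}
  tensorProd : ∀ {p q n} → BipartiteGraph p q n →
               (Fin p → Tensor n) → Tensor n
  tensorProd Γ Gs I = prodFin (λ i → Gs i (I ∩ incident Γ i))

  sameV : ∀ {p q n} → BipartiteGraph p q n → List (Fin n × Fin n) → Bool
  sameV Γ []             = true
  sameV Γ ((e , e') ∷ S) =
    does (BipartiteGraph.vtx Γ e ≟ᶠ BipartiteGraph.vtx Γ e') ∧ sameV Γ S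

  𝒮 : ∀ {p q n} → BipartiteGraph p q n → Subset n → List (List (Fin n × Fin n))
  𝒮 Γ I = filterᵇ (sameV Γ) (pairings _ (fromList (elems I)))

  _<ᵇ_ : ∀ {n} → Fin n → Fin n → Bool
  a <ᵇ b = does (a <? b)

  crosses : ∀ {n} → (Fin n × Fin n) → (Fin n × Fin n) → Bool
  crosses (e , e') (f , f') = (e <ᵇ f) ∧ ((f <ᵇ e') ∧ (e' <ᵇ f'))

  cr : ∀ {n} → List (Fin n × Fin n) → ℕ
  cr S = length (concatMap (λ P → filterᵇ (crosses P) S) S)

  zS : ∀ {n} → Matrix n → List (Fin n × Fin n) → Carrier
  zS z S = prodL (map (λ { (e , e') → z e e' }) S)

  matchingSum : ∀ {p q n} → BipartiteGraph p q n → Matrix n → Subset n → Carrier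
  matchingSum Γ z I = sumL (map (λ S → negPow (cr S) (zS z S)) (𝒮 Γ I))

-- Expanding the Pfaffian of an increasing principal submatrix along its first row, over
-- and over, writes Pfaff(z_I) as a sum over all pairings S of I. When the first index a
-- is paired with b, the sign is (-1)^k with k the number of remaining indices below b;
-- a later pair (y , y') crosses (a , b) exactly when one of y, y' lies below b, so k has
-- the parity of the number of pairs of S crossing (a , b), and the signs multiply up to
-- (-1)^cr(S). Only pairings whose pairs share a vertex survive: if vtx e ≠ vtx e', the
-- hypothesis on z at {e , e'} reads z_{e e'} = ∏_i (G_i)_{{e , e'} ∩ E_i}, and the factor
-- at i = vtx e is (G_i)_{{e}}, the Pfaffian of a 1 × 1 matrix, i.e. 0.

module Submission where

open import Defs
open import Level using (Level)
open import Algebra.Bundles using (CommutativeRing)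
import Algebra.Properties.Ring as RingProperties
open import Data.Bool using (Bool; true; false; T; _∧_)
open import Data.Bool.Properties using (T-∧)
open import Data.Empty using (⊥-elim)
open import Data.Fin using (Fin; _<_; _≟_)
open import Data.Fin.Properties using (_<?_; <-cmp; <-asym; <-irrefl; <-trans; <⇒≢; ≤∧≢⇒<)
open import Data.Fin.Subset using (Subset; _⊆_; _∩_)
open import Data.Fin.Subset.Properties using (p∩q⊆q)
open import Data.List using (List; []; _∷_; _++_; map; concat; concatMap; length; filterᵇ; allFin)
import Data.List.Properties as List
open import Data.List.Membership.Propositional using (_∈_)
open import Data.List.Membership.Propositional.Properties using (∈-allFin; ∈-filter⁺; ∈-filter⁻)
open import Data.List.Relation.Unary.All as All using (All; []; _∷_)
import Data.List.Relation.Unary.All.Properties as Allₚ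
open import Data.List.Relation.Unary.Any using (here; there)
open import Data.List.Relation.Unary.AllPairs as ListAllPairs using ([]; _∷_)
import Data.List.Relation.Unary.AllPairs.Properties as ListAllPairsₚ
open import Data.Nat as Nat using (ℕ; zero; suc)
open import Data.Nat.Divisibility using (_∣_; divides; ∣m∣n⇒∣m+n)
import Data.Nat.Properties as ℕₚ
open import Algebra.Properties.CommutativeSemigroup ℕₚ.+-commutativeSemigroup using (interchange; x∙yz≈y∙xz)
open import Data.Product using (_×_; _,_; proj₁; proj₂)
open import Data.Vec using (Vec; []; _∷_; lookup; tabulate; fromList; count)
open import Data.Vec.Properties using (lookup∘tabulate; lookup-zipWith)
open import Data.Vec.Relation.Unary.All as VecAll using ([]; _∷_)
import Data.Vec.Relation.Unary.All.Properties as VecAllₚ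
open import Data.Vec.Relation.Unary.AllPairs using (AllPairs; []; _∷_)
open import Function using (id; _∘_; _⇔_; mk⇔; Equivalence)
open import Function.Construct.Composition using (_⇔-∘_)
open import Relation.Binary using (Rel)
open import Relation.Binary.Definitions using (tri<; tri≈; tri>)
open import Relation.Binary.PropositionalEquality as ≡ using (_≡_; _≢_)
open import Relation.Nullary using (Dec; yes; no; does; ¬_)
open import Relation.Nullary.Decidable using (T?; dec-true; dec-false)
open import Relation.Unary using (Pred; Decidable)

private
  variable
    a b p : Level
    A B : Set a

bit : Bool → ℕ
bit false = 0
bit true  = 1

count-∷ : ∀ {P : Pred A p} (P? : Decidable P) {m} x (xs : Vec A m) →
  count P? (x ∷ xs) ≡ bit (does (P? x)) Nat.+ count P? xs
count-∷ P? x xs with does (P? x)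
... | true  = ≡.refl
... | false = ≡.refl

length-filterᵇ-∷ : ∀ (f : A → Bool) x xs →
  length (filterᵇ f (x ∷ xs)) ≡ bit (f x) Nat.+ length (filterᵇ f xs)
length-filterᵇ-∷ f x xs with f x
... | true  = ≡.refl
... | false = ≡.refl

filterᵇ-reject : ∀ (f : A → Bool) {x xs} → f x ≡ false → filterᵇ f (x ∷ xs) ≡ filterᵇ f xs
filterᵇ-reject f fx≡false = List.filter-reject (T? ∘ f) (≡.subst T fx≡false)

T-does : ∀ {P : Set p} (P? : Dec P) → T (does P?) ⇔ P
T-does (yes p) = mk⇔ (λ _ → p) _
T-does (no ¬p) = mk⇔ (λ ()) ¬p

AllPairs-fromList⁺ : ∀ {ℓ} {_~_ : Rel A ℓ} {xs : List A} →
  ListAllPairs.AllPairs _~_ xs → AllPairs _~_ (fromList xs)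
AllPairs-fromList⁺ []           = []
AllPairs-fromList⁺ (x~xs ∷ ~xs) = VecAllₚ.fromList⁺ x~xs ∷ AllPairs-fromList⁺ ~xs

data Pick {A : Set a} : ∀ {m} → Vec A (suc m) → A × ℕ × Vec A m → Set a where
  here  : ∀ {m x} {xs : Vec A m} → Pick (x ∷ xs) (x , 0 , xs)
  there : ∀ {m x y k} {xs : Vec A (suc m)} {ys : Vec A m} →
          Pick xs (y , k , ys) → Pick (x ∷ xs) (y , suc k , x ∷ ys)

picks-Pick : ∀ {m} (xs : Vec A (suc m)) → All (Pick xs) (picks xs)
picks-Pick {m = zero}  (x ∷ []) = here ∷ []
picks-Pick {m = suc m} (x ∷ xs) = here ∷ Allₚ.map⁺ (All.map (λ { {y , k , ys} → there }) (picks-Pick xs))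

Pick-All : ∀ {P : Pred A p} {m} {xs : Vec A (suc m)} {y k ys} →
  Pick xs (y , k , ys) → VecAll.All P xs → P y × VecAll.All P ys
Pick-All here         (py ∷ pys) = py , pys
Pick-All (there pick) (px ∷ pxs) = proj₁ (Pick-All pick pxs) , px ∷ proj₂ (Pick-All pick pxs)

Pick-AllPairs : ∀ {ℓ} {_~_ : Rel A ℓ} {m} {xs : Vec A (suc m)} {y k ys} →
  Pick xs (y , k , ys) → AllPairs _~_ xs → AllPairs _~_ ys
Pick-AllPairs here         (_ ∷ ~xs)    = ~xs
Pick-AllPairs (there pick) (x~xs ∷ ~xs) = proj₂ (Pick-All pick x~xs) ∷ Pick-AllPairs pick ~xs

Pick-count : ∀ {P : Pred A p} (P? : Decidable P) {m} {xs : Vec A (suc m)} {y k ys} →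
  Pick xs (y , k , ys) → count P? xs ≡ bit (does (P? y)) Nat.+ count P? ys
Pick-count P? {xs = y ∷ xs} here = count-∷ P? y xs
Pick-count P? {xs = x ∷ xs} {y} {ys = _ ∷ ys} (there pick) = begin
  count P? (x ∷ xs)                   ≡⟨ count-∷ P? x xs ⟩
  [x] + count P? xs                   ≡⟨ ≡.cong ([x] +_) (Pick-count P? pick) ⟩
  [x] + ([y] + count P? ys)           ≡⟨ x∙yz≈y∙xz [x] [y] (count P? ys) ⟩
  [y] + ([x] + count P? ys)           ≡⟨ ≡.cong ([y] +_) (count-∷ P? x ys) ⟨
  [y] + count P? (x ∷ ys)             ∎
  where
  open ≡.≡-Reasoning
  open Nat using (_+_)
  [x] [y] : ℕ
  [x] = bit (does (P? x))
  [y] = bit (does (P? y))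

module _ {ℓ} (Q : ∀ {m} → Vec A m → List (A × A) → Set ℓ)
         (Q-[] : Q [] [])
         (Q-∷ : ∀ {m x y k} {xs : Vec A (suc m)} {ys : Vec A m} {S} →
                Pick xs (y , k , ys) → Q ys S → Q (x ∷ xs) ((x , y) ∷ S)) where

  pairings-All : ∀ {m} (v : Vec A m) → All (Q v) (pairings m v)
  pairings-All {zero}        []       = Q-[] ∷ []
  pairings-All {suc zero}    _        = []
  pairings-All {suc (suc m)} (x ∷ xs) =
    Allₚ.concat⁺ (Allₚ.map⁺ (All.map extend (picks-Pick xs)))
    where
    extend : ∀ {t} → Pick xs t → All (Q (x ∷ xs)) (map ((x , proj₁ t) ∷_) (pairings m (proj₂ (proj₂ t))))
    extend pick = Allₚ.map⁺ (All.map (Q-∷ pick) (pairings-All _))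

module SignedSums {c ℓ} (R : CommutativeRing c ℓ) where
  open CommutativeRing R
  open RingProperties ring using (-‿involutive; -0#≈0#; -‿distribʳ-*; -‿+-comm)
  open import Relation.Binary.Reasoning.Setoid setoid

  ∑ : List A → (A → Carrier) → Carrier
  ∑ xs f = sumL R (map f xs)

  ∑-++ : ∀ (xs ys : List A) f → ∑ (xs ++ ys) f ≈ ∑ xs f + ∑ ys f
  ∑-++ []       ys f = sym (+-identityˡ _)
  ∑-++ (x ∷ xs) ys f = trans (+-congˡ (∑-++ xs ys f)) (sym (+-assoc _ _ _))

  ∑-concatMap : ∀ (xs : List A) (g : A → List B) f → ∑ (concatMap g xs) f ≈ ∑ xs (λ x → ∑ (g x) f)
  ∑-concatMap []       g f = refl
  ∑-concatMap (x ∷ xs) g f = trans (∑-++ (g x) (concatMap g xs) f) (+-congˡ (∑-concatMap xs g f))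

  ∑-map : ∀ (xs : List A) (g : A → B) f → ∑ (map g xs) f ≡ ∑ xs (f ∘ g)
  ∑-map xs g f = ≡.cong (sumL R) (≡.sym (List.map-∘ xs))

  ∑-cong : ∀ {xs : List A} {f g} → All (λ x → f x ≈ g x) xs → ∑ xs f ≈ ∑ xs g
  ∑-cong []              = refl
  ∑-cong (fx≈gx ∷ f≈g) = +-cong fx≈gx (∑-cong f≈g)

  *-distribˡ-∑ : ∀ y (xs : List A) f → y * ∑ xs f ≈ ∑ xs (λ x → y * f x)
  *-distribˡ-∑ y []       f = zeroʳ y
  *-distribˡ-∑ y (x ∷ xs) f = trans (distribˡ y _ _) (+-congˡ (*-distribˡ-∑ y xs f))

  ∑-filterᵇ : ∀ (keep : A → Bool) xs f → (∀ x → keep x ≡ false → f x ≈ 0#) →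
    ∑ xs f ≈ ∑ (filterᵇ keep xs) f
  ∑-filterᵇ keep []       f f≈0 = refl
  ∑-filterᵇ keep (x ∷ xs) f f≈0 with keep x in keep-x
  ... | true  = +-congˡ (∑-filterᵇ keep xs f f≈0)
  ... | false = trans (+-congʳ (f≈0 x keep-x)) (trans (+-identityˡ _) (∑-filterᵇ keep xs f f≈0))

  prodL-zero : ∀ (f : A → Carrier) {x xs} → x ∈ xs → f x ≈ 0# → prodL R (map f xs) ≈ 0#
  prodL-zero f (here ≡.refl) fx≈0 = trans (*-congʳ fx≈0) (zeroˡ _)
  prodL-zero f (there x∈xs)  fx≈0 = trans (*-congˡ (prodL-zero f x∈xs fx≈0)) (zeroʳ _)

  negPow-cong : ∀ k {x y} → x ≈ y → negPow R k x ≈ negPow R k y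
  negPow-cong zero    x≈y = x≈y
  negPow-cong (suc k) x≈y = -‿cong (negPow-cong k x≈y)

  negPow-+ : ∀ j k x → negPow R (j Nat.+ k) x ≡ negPow R j (negPow R k x)
  negPow-+ zero    k x = ≡.refl
  negPow-+ (suc j) k x = ≡.cong -_ (negPow-+ j k x)

  negPow-double : ∀ k x → negPow R (k Nat.+ k) x ≈ x
  negPow-double zero    x = refl
  negPow-double (suc k) x = begin
    - negPow R (k Nat.+ suc k) x ≡⟨ ≡.cong (λ j → - negPow R j x) (ℕₚ.+-suc k k) ⟩
    - - negPow R (k Nat.+ k) x   ≈⟨ -‿involutive _ ⟩
    negPow R (k Nat.+ k) x       ≈⟨ negPow-double k x ⟩
    x                            ∎

  negPow-parity : ∀ {j k} x → 2 ∣ j Nat.+ k → negPow R j x ≈ negPow R k x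
  negPow-parity {j} {k} x (divides q j+k≡q*2) = begin
    negPow R j x                            ≈⟨ negPow-cong j (negPow-double k x) ⟨
    negPow R j (negPow R (k Nat.+ k) x)     ≡⟨ ≡.trans (≡.cong (λ i → negPow R i x) (ℕₚ.+-assoc j k k))
                                                       (negPow-+ j (k Nat.+ k) x) ⟨
    negPow R ((j Nat.+ k) Nat.+ k) x        ≡⟨ ≡.cong (λ i → negPow R (i Nat.+ k) x)
                                                       (≡.trans j+k≡q*2 q*2≡q+q) ⟩
    negPow R ((q Nat.+ q) Nat.+ k) x        ≡⟨ negPow-+ (q Nat.+ q) k x ⟩
    negPow R (q Nat.+ q) (negPow R k x)     ≈⟨ negPow-double q _ ⟩
    negPow R k x                            ∎
    where
    q*2≡q+q : q Nat.* 2 ≡ q Nat.+ q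
    q*2≡q+q = ≡.trans (ℕₚ.*-comm q 2) (≡.cong (q Nat.+_) (ℕₚ.+-identityʳ q))

  negPow-*ˡ : ∀ k y x → negPow R k (y * x) ≈ y * negPow R k x
  negPow-*ˡ zero    y x = refl
  negPow-*ˡ (suc k) y x = trans (-‿cong (negPow-*ˡ k y x)) (-‿distribʳ-* y _)

  negPow-0# : ∀ k → negPow R k 0# ≈ 0#
  negPow-0# zero    = refl
  negPow-0# (suc k) = trans (-‿cong (negPow-0# k)) -0#≈0#

  negPow-∑ : ∀ k (xs : List A) f → negPow R k (∑ xs f) ≈ ∑ xs (negPow R k ∘ f)
  negPow-∑ zero    xs       f = refl
  negPow-∑ (suc k) []       f = negPow-0# (suc k)
  negPow-∑ (suc k) (x ∷ xs) f = begin
    - negPow R k (f x + ∑ xs f)                      ≈⟨ -‿cong (negPow-∑ k (x ∷ xs) f) ⟩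
    - (negPow R k (f x) + ∑ xs (negPow R k ∘ f))     ≈⟨ -‿+-comm _ _ ⟨
    - negPow R k (f x) + - ∑ xs (negPow R k ∘ f)     ≈⟨ +-congˡ (-‿cong (negPow-∑ k xs f)) ⟨
    - negPow R k (f x) + - negPow R k (∑ xs f)       ≈⟨ +-congˡ (negPow-∑ (suc k) xs f) ⟩
    - negPow R k (f x) + ∑ xs (negPow R (suc k) ∘ f) ∎

-- Crossings

-- crosses and cr are defined inside the ring module of Defs, so they take a ring argument
-- that they ignore.
module Crossings {c ℓ} (R : CommutativeRing c ℓ) {n : ℕ} where
  open Nat using (_+_)
  open ≡ using (refl; sym; trans; cong; cong₂; subst)
  open ≡.≡-Reasoning

  Increasing : ∀ {m} → Vec (Fin n) m → Set
  Increasing = AllPairs _<_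

  below : ∀ {m} → Fin n → Vec (Fin n) m → ℕ
  below b = count (_<? b)

  crossings : Fin n × Fin n → List (Fin n × Fin n) → ℕ
  crossings P S = length (filterᵇ (crosses R P) S)

  below-none : ∀ {m b} {ys : Vec (Fin n) m} → VecAll.All (b <_) ys → below b ys ≡ 0
  below-none []                             = refl
  below-none {b = b} {w ∷ ys} (b<w ∷ b<ys) =
    trans (count-∷ (_<? b) w ys) (cong₂ _+_ (cong bit (dec-false (w <? b) (<-asym b<w))) (below-none b<ys))

  Pick-position : ∀ {m} {xs : Vec (Fin n) (suc m)} {y k ys} →
    Increasing xs → Pick xs (y , k , ys) → k ≡ below y ys
  Pick-position (y<xs ∷ _) here = sym (below-none y<xs)
  Pick-position {y = y} {suc k} (x<xs ∷ inc) (there {x = x} {ys = ys} pick) = begin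
    suc k                            ≡⟨ cong suc (Pick-position inc pick) ⟩
    bit true + below y ys            ≡⟨ cong (λ t → bit t + below y ys)
                                             (dec-true (x <? y) (proj₁ (Pick-All pick x<xs))) ⟨
    bit (does (x <? y)) + below y ys ≡⟨ count-∷ (_<? y) x ys ⟨
    below y (x ∷ ys)                 ∎

  Pick-≢ : ∀ {m} {xs : Vec (Fin n) (suc m)} {y k ys} →
    Increasing xs → Pick xs (y , k , ys) → VecAll.All (_≢ y) ys
  Pick-≢ (y<xs ∷ _)   here         = VecAll.map (λ y<w w≡y → <⇒≢ y<w (sym w≡y)) y<xs
  Pick-≢ (x<xs ∷ inc) (there pick) = <⇒≢ (proj₁ (Pick-All pick x<xs)) ∷ Pick-≢ inc pick

  not-crosses : ∀ (P Q : Fin n × Fin n) → ¬ proj₁ P < proj₁ Q → crosses R P Q ≡ false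
  not-crosses (e , e') (f , f') e≮f = cong (_∧ does (f <? e') ∧ does (e' <? f')) (dec-false (e <? f) e≮f)

  -- For a < y < y', the pair (y , y') crosses (a , b) iff exactly one of y, y' lies below b.
  chord-parity : ∀ {y y' b : Fin n} → y < y' → y' ≢ b →
    2 ∣ bit (does (y <? b) ∧ does (b <? y')) + (bit (does (y <? b)) + bit (does (y' <? b)))
  chord-parity {y} {y'} {b} y<y' y'≢b with y <? b | y' <? b
  ... | yes y<b | yes y'<b
    rewrite dec-true (y <? b) y<b | dec-true (y' <? b) y'<b | dec-false (b <? y') (<-asym y'<b) = divides 1 refl
  ... | yes y<b | no y'≮b
    rewrite dec-true (y <? b) y<b | dec-false (y' <? b) y'≮b
          | dec-true (b <? y') (≤∧≢⇒< (ℕₚ.≮⇒≥ y'≮b) (y'≢b ∘ sym)) = divides 1 refl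
  ... | no y≮b  | yes y'<b = ⊥-elim (y≮b (<-trans y<y' y'<b))
  ... | no y≮b  | no y'≮b
    rewrite dec-false (y <? b) y≮b | dec-false (y' <? b) y'≮b = divides 0 refl

  CrossingParity : Fin n → Fin n → ∀ {m} → Vec (Fin n) m → List (Fin n × Fin n) → Set
  CrossingParity a b ys S = Increasing ys → VecAll.All (a <_) ys → VecAll.All (_≢ b) ys →
                            2 ∣ crossings (a , b) S + below b ys

  crossings-parity : ∀ {m} (ys : Vec (Fin n) m) (a b : Fin n) → All (CrossingParity a b ys) (pairings m ys)
  crossings-parity ys a b = pairings-All (CrossingParity a b) (λ _ _ _ → divides 0 refl) step ys
    where
    step : ∀ {m y y' k} {xs : Vec (Fin n) (suc m)} {ys S} →
      Pick xs (y' , k , ys) → CrossingParity a b ys S → CrossingParity a b (y ∷ xs) ((y , y') ∷ S)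
    step {y = y} {y'} {xs = xs} {ys} {S} pick parity (y<xs ∷ inc) (a<y ∷ a<xs) (_ ∷ xs≢b) =
      subst (2 ∣_) (sym regroup)
        (∣m∣n⇒∣m+n (chord-parity (proj₁ (Pick-All pick y<xs)) (proj₁ (Pick-All pick xs≢b)))
                   (parity (Pick-AllPairs pick inc) (proj₂ (Pick-All pick a<xs)) (proj₂ (Pick-All pick xs≢b))))
      where
      χ β β' : ℕ
      χ  = bit (does (y <? b) ∧ does (b <? y'))
      β  = bit (does (y <? b))
      β' = bit (does (y' <? b))
      crossings-∷ : crossings (a , b) ((y , y') ∷ S) ≡ χ + crossings (a , b) S
      crossings-∷ = trans (length-filterᵇ-∷ (crosses R (a , b)) (y , y') S)
                          (cong (λ t → bit (t ∧ does (y <? b) ∧ does (b <? y')) + crossings (a , b) S)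
                                (dec-true (a <? y) a<y))
      below-∷ : below b (y ∷ xs) ≡ (β + β') + below b ys
      below-∷ = trans (count-∷ (_<? b) y xs)
                      (trans (cong (β +_) (Pick-count (_<? b) pick)) (sym (ℕₚ.+-assoc β β' _)))
      regroup : crossings (a , b) ((y , y') ∷ S) + below b (y ∷ xs)
              ≡ (χ + (β + β')) + (crossings (a , b) S + below b ys)
      regroup = trans (cong₂ _+_ crossings-∷ below-∷) (interchange χ _ _ _)

  pairings-above : ∀ {m} (v : Vec (Fin n) m) (a : Fin n) →
    All (λ S → VecAll.All (a <_) v → All (λ P → a < proj₁ P) S) (pairings m v)
  pairings-above v a = pairings-All (λ v S → VecAll.All (a <_) v → All (λ P → a < proj₁ P) S)
    (λ _ → [])
    (λ { pick above (a<x ∷ a<xs) → a<x ∷ above (proj₂ (Pick-All pick a<xs)) })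
    v

  cr-∷ : ∀ (a b : Fin n) S → All (λ P → a < proj₁ P) S →
    cr R ((a , b) ∷ S) ≡ crossings (a , b) S + cr R S
  cr-∷ a b S a<S = begin
    cr R ((a , b) ∷ S)
      ≡⟨ List.length-++ (filterᵇ (crosses R (a , b)) ((a , b) ∷ S)) ⟩
    length (filterᵇ (crosses R (a , b)) ((a , b) ∷ S))
      + length (concatMap (λ P → filterᵇ (crosses R P) ((a , b) ∷ S)) S)
      ≡⟨ cong₂ _+_ (cong length (filterᵇ-reject (crosses R (a , b)) {a , b} {S}
                                    (not-crosses (a , b) (a , b) (<-irrefl (refl {x = a})))))
                   (cong (length ∘ concat) (List.map-cong-local (All.map (λ {P} → not-crossed {P}) a<S))) ⟩
    crossings (a , b) S + cr R S ∎
    where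
    not-crossed : ∀ {P : Fin n × Fin n} → a < proj₁ P →
      filterᵇ (crosses R P) ((a , b) ∷ S) ≡ filterᵇ (crosses R P) S
    not-crossed {P} a<P = filterᵇ-reject (crosses R P) {a , b} {S} (not-crosses P (a , b) (<-asym a<P))

-- The Pfaffian as a signed sum over pairings

module Expansion {c ℓ} (R : CommutativeRing c ℓ) {n : ℕ} (z : Matrix R n) where
  open CommutativeRing R
  open SignedSums R
  open Crossings R
  open import Relation.Binary.Reasoning.Setoid setoid

  signedTerm : List (Fin n × Fin n) → Carrier
  signedTerm S = negPow R (cr R S) (zS R z S)

  signedTerm-∷ : ∀ {a b : Fin n} {k S} → 2 ∣ crossings (a , b) S Nat.+ k → All (λ P → a < proj₁ P) S →
    negPow R k (z a b * signedTerm S) ≈ signedTerm ((a , b) ∷ S)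
  signedTerm-∷ {a} {b} {k} {S} parity a<S = begin
    negPow R k (z a b * negPow R (cr R S) zab-S)
      ≈⟨ negPow-cong k (negPow-*ˡ (cr R S) (z a b) _) ⟨
    negPow R k (negPow R (cr R S) (z a b * zab-S))
      ≈⟨ negPow-parity {crossings (a , b) S} {k} (negPow R (cr R S) (z a b * zab-S)) parity ⟨
    negPow R (crossings (a , b) S) (negPow R (cr R S) (z a b * zab-S))
      ≡⟨ ≡.trans (≡.cong (λ i → negPow R i (z a b * zab-S)) (cr-∷ a b S a<S))
                 (negPow-+ (crossings (a , b) S) (cr R S) (z a b * zab-S)) ⟨
    negPow R (cr R ((a , b) ∷ S)) (z a b * zab-S) ∎
    where
    zab-S : Carrier
    zab-S = zS R z S

  PfaffVec-expansion : ∀ {m} (v : Vec (Fin n) m) → Increasing v →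
    PfaffVec R z m v ≈ ∑ (pairings m v) signedTerm
  PfaffVec-expansion {zero}        []       []           = sym (+-identityʳ 1#)
  PfaffVec-expansion {suc zero}    _        _            = refl
  PfaffVec-expansion {suc (suc m)} (a ∷ xs) (a<xs ∷ inc) =
    trans (∑-cong (All.map (λ { {b , k , ys} → expand-pick }) (picks-Pick xs)))
          (sym (∑-concatMap (picks xs) _ signedTerm))
    where
    expand-pick : ∀ {b k ys} → Pick xs (b , k , ys) →
      negPow R k (z a b * PfaffVec R z m ys) ≈ ∑ (map ((a , b) ∷_) (pairings m ys)) signedTerm
    expand-pick {b} {k} {ys} pick = begin
      negPow R k (z a b * PfaffVec R z m ys)
        ≈⟨ negPow-cong k (*-congˡ (PfaffVec-expansion ys (Pick-AllPairs pick inc))) ⟩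
      negPow R k (z a b * ∑ (pairings m ys) signedTerm)
        ≈⟨ negPow-cong k (*-distribˡ-∑ (z a b) (pairings m ys) signedTerm) ⟩
      negPow R k (∑ (pairings m ys) (λ S → z a b * signedTerm S))
        ≈⟨ negPow-∑ k (pairings m ys) _ ⟩
      ∑ (pairings m ys) (λ S → negPow R k (z a b * signedTerm S))
        ≈⟨ ∑-cong (All.zipWith (λ (parity , above) → signedTerm-∷ parity above) (parities , aboves)) ⟩
      ∑ (pairings m ys) (signedTerm ∘ ((a , b) ∷_))
        ≡⟨ ∑-map (pairings m ys) ((a , b) ∷_) signedTerm ⟨
      ∑ (map ((a , b) ∷_) (pairings m ys)) signedTerm ∎
      where
      a<ys : VecAll.All (a <_) ys
      a<ys = proj₂ (Pick-All pick a<xs)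
      parities : All (λ S → 2 ∣ crossings (a , b) S Nat.+ k) (pairings m ys)
      parities = All.map (λ parity → ≡.subst (λ j → 2 ∣ _ Nat.+ j) (≡.sym (Pick-position inc pick))
                                             (parity (Pick-AllPairs pick inc) a<ys (Pick-≢ inc pick)))
                         (crossings-parity ys a b)
      aboves : All (All (λ P → a < proj₁ P)) (pairings m ys)
      aboves = All.map (λ above → above a<ys) (pairings-above ys a)

module Enumeration {n : ℕ} where
  open ≡ using (refl; sym; subst; cong)
  open Equivalence using (to; from)
  open import Data.List.Membership.DecPropositional (_≟_ {n}) using (_∈?_)

  IncreasingList : List (Fin n) → Set
  IncreasingList = ListAllPairs.AllPairs _<_

  private
    heads-≡ : ∀ {x y} {xs ys : List (Fin n)} → All (x <_) xs → All (y <_) ys →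
      x ∈ y ∷ ys → y ∈ x ∷ xs → x ≡ y
    heads-≡ _    _    (here x≡y)   _            = x≡y
    heads-≡ _    _    (there _)    (here y≡x)   = sym y≡x
    heads-≡ x<xs y<ys (there x∈ys) (there y∈xs) =
      ⊥-elim (<-asym (All.lookup x<xs y∈xs) (All.lookup y<ys x∈ys))

    ∈-tail : ∀ {x w} {xs ys : List (Fin n)} → All (x <_) xs → w ∈ xs → w ∈ x ∷ ys → w ∈ ys
    ∈-tail x<xs w∈xs (here w≡x)   = ⊥-elim (<-irrefl (sym w≡x) (All.lookup x<xs w∈xs))
    ∈-tail _    _    (there w∈ys) = w∈ys

  increasing-unique : ∀ {xs ys} → IncreasingList xs → IncreasingList ys →
    (∀ {x} → x ∈ xs ⇔ x ∈ ys) → xs ≡ ys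
  increasing-unique []      []      _     = refl
  increasing-unique []      (_ ∷ _) xs⇔ys with () ← from xs⇔ys (here refl)
  increasing-unique (_ ∷ _) []      xs⇔ys with () ← to xs⇔ys (here refl)
  increasing-unique {x ∷ xs} {y ∷ ys} (x<xs ∷ inc-xs) (y<ys ∷ inc-ys) xs⇔ys
    with refl ← heads-≡ x<xs y<ys (to xs⇔ys (here refl)) (from xs⇔ys (here refl)) =
    cong (x ∷_) (increasing-unique inc-xs inc-ys
      (mk⇔ (λ w∈xs → ∈-tail x<xs w∈xs (to xs⇔ys (there w∈xs)))
           (λ w∈ys → ∈-tail y<ys w∈ys (from xs⇔ys (there w∈ys)))))

  elems-increasing : ∀ (I : Subset n) → IncreasingList (elems I)
  elems-increasing I = ListAllPairsₚ.filter⁺ (T? ∘ lookup I) (ListAllPairsₚ.tabulate⁺-< id)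

  ∈-elems : ∀ {I : Subset n} {x} → x ∈ elems I ⇔ T (lookup I x)
  ∈-elems {I} {x} = mk⇔ (proj₂ ∘ ∈-filter⁻ (T? ∘ lookup I) {xs = allFin n})
                        (∈-filter⁺ (T? ∘ lookup I) (∈-allFin x))

  elems-unique : ∀ {I : Subset n} {L} → IncreasingList L →
    (∀ {x} → T (lookup I x) ⇔ x ∈ L) → elems I ≡ L
  elems-unique {I} inc-L I⇔L = increasing-unique (elems-increasing I) inc-L (I⇔L ⇔-∘ ∈-elems {I})

  ⟦_⟧ : List (Fin n) → Subset n
  ⟦ L ⟧ = tabulate (λ x → does (x ∈? L))

  T-⟦⟧ : ∀ {L x} → T (lookup ⟦ L ⟧ x) ⇔ x ∈ L
  T-⟦⟧ {L} {x} = subst (λ t → T t ⇔ x ∈ L) (sym (lookup∘tabulate _ x)) (T-does (x ∈? L))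

  T-∩ : ∀ {I J : Subset n} {x} → T (lookup (I ∩ J) x) ⇔ (T (lookup I x) × T (lookup J x))
  T-∩ {I} {J} {x} =
    subst (λ t → T t ⇔ (T (lookup I x) × T (lookup J x))) (sym (lookup-zipWith _∧_ x I J)) T-∧

-- Block structure of z

module BlockStructure {c ℓ} (R : CommutativeRing c ℓ) {p q n} (Γ : BipartiteGraph p q n)
  (Gs : Fin p → Tensor R n) (zs : Fin p → Matrix R n) (z : Matrix R n)
  (Gs≈sPf : ∀ i I → I ⊆ incident Γ i → CommutativeRing._≈_ R (Gs i I) (sPf R (zs i) I))
  (sPf≈⊗ : ∀ I → CommutativeRing._≈_ R (sPf R z I) (tensorProd R Γ Gs I)) where
  open CommutativeRing R
  open RingProperties ring using (-0#≈0#)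
  open SignedSums R
  open Expansion R z
  open BipartiteGraph Γ
  open Enumeration {n}
  open Equivalence using (to; from)
  open import Relation.Binary.Reasoning.Setoid setoid

  T-incident : ∀ {i x} → T (lookup (incident Γ i) x) ⇔ vtx x ≡ i
  T-incident {i} {x} = ≡.subst (λ t → T t ⇔ vtx x ≡ i) (≡.sym (lookup∘tabulate _ x)) (T-does (vtx x ≟ i))

  PfaffSub-elems : ∀ (w : Matrix R n) {I L} → elems I ≡ L →
    PfaffSub R w I ≡ PfaffVec R w (length L) (fromList L)
  PfaffSub-elems w = ≡.cong (λ L → PfaffVec R w (length L) (fromList L))

  entry-vanishes-< : ∀ {e e'} → e < e' → vtx e ≢ vtx e' → z e e' ≈ 0#
  entry-vanishes-< {e} {e'} e<e' vtx-e≢vtx-e' = begin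
    z e e'                ≈⟨ trans (+-identityʳ _) (*-identityʳ _) ⟨
    z e e' * 1# + 0#      ≡⟨ PfaffSub-elems z {I} (elems-unique {I} ((e<e' ∷ []) ∷ [] ∷ []) T-⟦⟧) ⟨
    sPf R z I             ≈⟨ sPf≈⊗ I ⟩
    tensorProd R Γ Gs I   ≈⟨ prodL-zero _ (∈-allFin (vtx e)) factor-vanishes ⟩
    0#                    ∎
    where
    L : List (Fin n)
    L = e ∷ e' ∷ []
    I J : Subset n
    I = ⟦ L ⟧
    J = I ∩ incident Γ (vtx e)
    only-e : ∀ {x} → x ∈ L → vtx x ≡ vtx e → x ∈ e ∷ []
    only-e (here x≡e)            _            = here x≡e
    only-e (there (here ≡.refl)) vtx-e'≡vtx-e = ⊥-elim (vtx-e≢vtx-e' (≡.sym vtx-e'≡vtx-e))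
    J⇔e : ∀ {x} → T (lookup J x) ⇔ x ∈ e ∷ []
    J⇔e = mk⇔
      (λ x∈J → let x∈I , x∈E = to (T-∩ {I}) x∈J in only-e (to (T-⟦⟧ {L}) x∈I) (to T-incident x∈E))
      (λ { (here ≡.refl) → from (T-∩ {I}) (from (T-⟦⟧ {L}) (here ≡.refl) , from T-incident ≡.refl) })
    factor-vanishes : Gs (vtx e) J ≈ 0#
    factor-vanishes = trans (Gs≈sPf (vtx e) J (p∩q⊆q I (incident Γ (vtx e))))
                            (reflexive (PfaffSub-elems (zs (vtx e)) {J} (elems-unique {J} ([] ∷ []) J⇔e)))

  entry-vanishes : SkewSymmetric R z → ∀ {e e'} → vtx e ≢ vtx e' → z e e' ≈ 0#
  entry-vanishes skew {e} {e'} vtx-e≢vtx-e' with <-cmp e e'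
  ... | tri< e<e' _ _ = entry-vanishes-< e<e' vtx-e≢vtx-e'
  ... | tri≈ _ e≡e' _ = ⊥-elim (vtx-e≢vtx-e' (≡.cong vtx e≡e'))
  ... | tri> _ _ e'<e =
    trans (proj₁ skew e e') (trans (-‿cong (entry-vanishes-< e'<e (vtx-e≢vtx-e' ∘ ≡.sym))) -0#≈0#)

  signedTerm-vanishes : SkewSymmetric R z → ∀ S → sameV R Γ S ≡ false → signedTerm S ≈ 0#
  signedTerm-vanishes skew S not-sameV = trans (negPow-cong (cr R S) (zS-vanishes S not-sameV)) (negPow-0# (cr R S))
    where
    zS-vanishes : ∀ S → sameV R Γ S ≡ false → zS R z S ≈ 0#
    zS-vanishes ((e , e') ∷ S) not-sameV with vtx e ≟ vtx e'
    ... | yes _               = trans (*-congˡ (zS-vanishes S not-sameV)) (zeroʳ _)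
    ... | no vtx-e≢vtx-e'     = trans (*-congʳ (entry-vanishes skew vtx-e≢vtx-e')) (zeroˡ _)

proposition6p1 : ∀ {c ℓ} (R : CommutativeRing c ℓ) →
    let open CommutativeRing R in
    ∀ {p q n} (Γ : BipartiteGraph p q n) → IsGeneratorOrder Γ →
    (Gs : Fin p → Tensor R n) →
    (zs : Fin p → Matrix R n) →
    (∀ i → SkewSymmetric R (zs i)) →
    (∀ i (I : Subset n) → I ⊆ incident Γ i → Gs i I ≈ sPf R (zs i) I) →
    (z : Matrix R n) → SkewSymmetric R z →
    (∀ (I : Subset n) → sPf R z I ≈ tensorProd R Γ Gs I) →
    ∀ (I : Subset n) →
      (tensorProd R Γ Gs I ≈ PfaffSub R z I)
      × (PfaffSub R z I ≈ matchingSum R Γ z I)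
proposition6p1 R {n = n} Γ _ Gs zs _ Gs≈sPf z z-skew sPf≈⊗ I = sym (sPf≈⊗ I) , (begin
  PfaffSub R z I
    ≈⟨ PfaffVec-expansion v (AllPairs-fromList⁺ (elems-increasing I)) ⟩
  ∑ (pairings _ v) signedTerm
    ≈⟨ ∑-filterᵇ (sameV R Γ) (pairings _ v) signedTerm (signedTerm-vanishes z-skew) ⟩
  matchingSum R Γ z I ∎)
  where
  open CommutativeRing R
  open SignedSums R
  open Expansion R z
  open Enumeration
  open BlockStructure R Γ Gs zs z Gs≈sPf sPf≈⊗
  open import Relation.Binary.Reasoning.Setoid setoid
  v : Vec (Fin n) (length (elems I))
  v = fromList (elems I)
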